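{- Let $\alpha,\beta<\varepsilon_0$ be such that $\alpha$ meshes with $\beta$. Then for every ordinal $\gamma$ and all natural numbers $n,x$ we have $$\beta\searrow_n^x\gamma\iff\alpha+\beta\searrow_n^x\alpha+\gamma.$$ Furthermore, if $\alpha+\beta\searrow_n^x 0$ then $\alpha+\beta\searrow_n^x\alpha$, and consequently $\beta\searrow_n^x0$.
   Context: Fundamental sequences: $\{0\}(n)=0$, $\{\alpha+1\}(n)=\alpha$; for limit $\alpha=\gamma+\omega^{\delta}$ (Cantor normal form, $\delta>0$), $\{\alpha\}(n)=\gamma+\omega^{\delta'}\cdot(n+1)$ if $\delta=\delta'+1$, and $\{\alpha\}(n)=\gamma+\omega^{\{\delta\}(n)}$ if $\delta$ is a limit. $\alpha$ meshes with $\beta$ if $\alpha=0$ or $\beta<\omega^{\alpha_0+1}$, where $\alpha_0$ is the smallest exponent in the Cantor normal form of $\alpha$. $\mathrm{fund}(\alpha,n,0)=\alpha$, $\mathrm{fund}(\alpha,n,x+1)=\{\mathrm{fund}(\alpha,n,x)\}(n)$; $\alpha\searrow_n^x\beta$ means $\exists y\leq x\;\mathrm{fund}(\alpha,n,y)=\beta$. -}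

module Defs where

open import Data.Nat using (ℕ; zero; suc; _≤_)
open import Data.Product using (Σ; _×_; _,_)
open import Relation.Binary.PropositionalEquality using (_≡_)
open import Data.Sum using (_⊎_)
open import Data.Unit using (⊤)
open import Data.Bool using (Bool; true; false; if_then_else_)

-- Ordinal notations below ε₀: Cantor normal form terms.
-- ω^ a + b  denotes  ω^a + b.
data Ord : Set where
  𝟎     : Ord
  ω^_+_ : Ord → Ord → Ord

infixr 6 ω^_+_

data Cmp : Set where
  lt eq gt : Cmp

cmp : Ord → Ord → Cmp
cmp 𝟎 𝟎 = eq
cmp 𝟎 (ω^ _ + _) = lt
cmp (ω^ _ + _) 𝟎 = gt
cmp (ω^ a + b) (ω^ c + d) with cmp a c
... | lt = lt
... | gt = gt
... | eq = cmp b d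

_<_ : Ord → Ord → Set
a < b = cmp a b ≡ lt

_≤ₒ_ : Ord → Ord → Set
a ≤ₒ b = (a < b) ⊎ (a ≡ b)

LeadLe : Ord → Ord → Set
LeadLe 𝟎 a = ⊤
LeadLe (ω^ c + _) a = c ≤ₒ a

data NF : Ord → Set where
  nf𝟎 : NF 𝟎
  nfω : ∀ {a b} → NF a → NF b → LeadLe b a → NF (ω^ a + b)

_⊕_ : Ord → Ord → Ord
𝟎 ⊕ b = b
(ω^ a + a') ⊕ 𝟎 = ω^ a + a'
(ω^ a + a') ⊕ (ω^ c + d) with cmp a c
... | lt = ω^ c + d
... | _  = ω^ a + (a' ⊕ (ω^ c + d))

infixl 5 _⊕_

𝟏 : Ord
𝟏 = ω^ 𝟎 + 𝟎

-- smallest (= last) exponent of the Cantor normal form (0 for 𝟎, unused there)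
lastExp : Ord → Ord
lastExp 𝟎 = 𝟎
lastExp (ω^ a + 𝟎) = a
lastExp (ω^ a + (ω^ c + d)) = lastExp (ω^ c + d)

isSucc : Ord → Bool
isSucc 𝟎 = false
isSucc (ω^ 𝟎 + 𝟎) = true
isSucc (ω^ (ω^ _ + _) + 𝟎) = false
isSucc (ω^ _ + (ω^ c + d)) = isSucc (ω^ c + d)

copies : Ord → ℕ → Ord
copies d zero = 𝟎
copies d (suc k) = ω^ d + copies d k

-- Writing α = γ + ω^δ, the recursion on the
-- CNF term keeps the prefix γ and acts on the last term ω^δ:
--   {0}(n) = 0,  {γ+ω^0}(n) = γ   (i.e. {α+1}(n) = α),
--   {γ+ω^(δ'+1)}(n) = γ + ω^δ'·(n+1),  {γ+ω^δ}(n) = γ + ω^({δ}(n)) for δ limit.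
-- (For δ = δ'+1 we have {δ}(n) = δ'.)
fs : Ord → ℕ → Ord
fs 𝟎 n = 𝟎
fs (ω^ a + (ω^ c + d)) n = ω^ a + fs (ω^ c + d) n
fs (ω^ 𝟎 + 𝟎) n = 𝟎
fs (ω^ (ω^ a + b) + 𝟎) n =
  if isSucc (ω^ a + b)
  then copies (fs (ω^ a + b) n) (suc n)
  else ω^ (fs (ω^ a + b) n) + 𝟎

Meshes : Ord → Ord → Set
Meshes α β = (α ≡ 𝟎) ⊎ (β < (ω^ (lastExp α ⊕ 𝟏) + 𝟎))

fund : Ord → ℕ → ℕ → Ord
fund α n zero = α
fund α n (suc x) = fs (fund α n x) n

_↘[_,_]_ : Ord → ℕ → ℕ → Ord → Set
α ↘[ n , x ] β = Σ ℕ (λ y → (y ≤ x) × (fund α n y ≡ β))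

module Submission where

-- Write α ++ β for the concatenation of Cantor normal
-- forms.  The fundamental sequence only acts on the last CNF term, so the
-- descent of α ++ β copies the descent of β behind the fixed prefix α for as
-- long as β has not reached 0, and reaches exactly α at the step where β hits
-- 0; afterwards it only decreases (the view 'Tracking' below).  Meshing says
-- that the leading exponent of β, hence of every stage of its descent, is at
-- most the last exponent of α; for such ordinals addition is concatenation,
-- α ⊕ w ≡ α ++ w, and conversely α ⊕ γ ≡ α ++ w forces γ ≡ w.

open import Defs
open import Data.Nat using (ℕ; zero; suc; _≤_; z≤n; _≤′_; ≤′-refl; ≤′-step)
open import Data.Nat.Properties using (≤-refl; ≤-trans; n≤1+n; ≤⇒≤′)
open import Data.Product using (_×_; _,_)
open import Data.Sum using (_⊎_; inj₁; inj₂)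
open import Data.Unit using (tt)
open import Data.Empty using (⊥-elim)
open import Data.Bool using (true; false; if_then_else_)
open import Relation.Nullary using (¬_)
open import Relation.Binary.PropositionalEquality
  using (_≡_; _≢_; refl; sym; trans; cong; cong₂; subst; subst₂; module ≡-Reasoning)
open import Function using (id)
open import Function.Bundles using (_⇔_; mk⇔)

cmp-refl : ∀ a → cmp a a ≡ eq
cmp-refl 𝟎 = refl
cmp-refl (ω^ a + b) rewrite cmp-refl a = cmp-refl b

cmp≡eq⇒≡ : ∀ {a b} → cmp a b ≡ eq → a ≡ b
cmp≡eq⇒≡ {𝟎} {𝟎} _ = refl
cmp≡eq⇒≡ {ω^ a + b} {ω^ c + d} p with cmp a c in a=c
... | eq = cong₂ ω^_+_ (cmp≡eq⇒≡ a=c) (cmp≡eq⇒≡ p)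

cmp-ω-lt : ∀ a b c d → a < c → (ω^ a + b) < (ω^ c + d)
cmp-ω-lt a b c d a<c rewrite a<c = refl

cmp-ω-eq : ∀ a b d → b < d → (ω^ a + b) < (ω^ a + d)
cmp-ω-eq a b d b<d rewrite cmp-refl a = b<d

cmp-ω-inv : ∀ a b c d → (ω^ a + b) < (ω^ c + d) → (a < c) ⊎ ((a ≡ c) × (b < d))
cmp-ω-inv a b c d p with cmp a c in a?c
... | lt = inj₁ refl
... | eq = inj₂ (cmp≡eq⇒≡ a?c , p)

<-irrefl : ∀ {a} → ¬ (a < a)
<-irrefl {a} p with trans (sym p) (cmp-refl a)
... | ()

≮𝟎 : ∀ {a} → ¬ (a < 𝟎)
≮𝟎 {𝟎} ()
≮𝟎 {ω^ _ + _} ()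

<-trans : ∀ {a b c} → a < b → b < c → a < c
<-trans {𝟎} {ω^ _ + _} {ω^ _ + _} _ _ = refl
<-trans {ω^ a + b} {ω^ c + d} {ω^ e + f} p q with cmp-ω-inv a b c d p | cmp-ω-inv c d e f q
... | inj₁ a<c          | inj₁ c<e          = cmp-ω-lt a b e f (<-trans {a} {c} {e} a<c c<e)
... | inj₁ a<c          | inj₂ (refl , _)   = cmp-ω-lt a b e f a<c
... | inj₂ (refl , _)   | inj₁ c<e          = cmp-ω-lt a b e f c<e
... | inj₂ (refl , b<d) | inj₂ (refl , d<f) = cmp-ω-eq a b f (<-trans {b} {d} {f} b<d d<f)

≤ₒ-<-trans : ∀ {a b c} → a ≤ₒ b → b < c → a < c
≤ₒ-<-trans {a} {b} {c} (inj₁ a<b) b<c = <-trans {a} {b} {c} a<b b<c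
≤ₒ-<-trans (inj₂ refl) b<c = b<c

<-≤ₒ-trans : ∀ {a b c} → a < b → b ≤ₒ c → a < c
<-≤ₒ-trans {a} {b} {c} a<b (inj₁ b<c) = <-trans {a} {b} {c} a<b b<c
<-≤ₒ-trans a<b (inj₂ refl) = a<b

≤ₒ-trans : ∀ {a b c} → a ≤ₒ b → b ≤ₒ c → a ≤ₒ c
≤ₒ-trans {a} {b} {c} a≤b (inj₁ b<c) = inj₁ (≤ₒ-<-trans {a} {b} {c} a≤b b<c)
≤ₒ-trans a≤b (inj₂ refl) = a≤b

≤ₒ-antisym : ∀ {a b} → a ≤ₒ b → b ≤ₒ a → a ≡ b
≤ₒ-antisym (inj₂ a≡b) _ = a≡b
≤ₒ-antisym (inj₁ _) (inj₂ b≡a) = sym b≡a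
≤ₒ-antisym {a} {b} (inj₁ a<b) (inj₁ b<a) = ⊥-elim (<-irrefl {a} (<-trans {a} {b} {a} a<b b<a))

cons-mono-≤ₒ : ∀ a {b d} → b ≤ₒ d → (ω^ a + b) ≤ₒ (ω^ a + d)
cons-mono-≤ₒ a {b} {d} (inj₁ b<d) = inj₁ (cmp-ω-eq a b d b<d)
cons-mono-≤ₒ a (inj₂ refl) = inj₂ refl

LeadLe-antitone : ∀ {x y e} → LeadLe y e → x ≤ₒ y → LeadLe x e
LeadLe-antitone {𝟎} _ _ = tt
LeadLe-antitone {ω^ _ + _} lead (inj₂ refl) = lead
LeadLe-antitone {ω^ c + d} {ω^ c′ + d′} lead (inj₁ x<y) with cmp-ω-inv c d c′ d′ x<y
... | inj₁ c<c′ = inj₁ (<-≤ₒ-trans {c} {c′} c<c′ lead)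
... | inj₂ (refl , _) = lead

infixr 5 _++_

tail : Ord → Ord
tail 𝟎 = 𝟎
tail (ω^ _ + t) = t

_++_ : Ord → Ord → Ord
𝟎 ++ β = β
(ω^ a + a') ++ β = ω^ a + (a' ++ β)

++-𝟎 : ∀ α → α ++ 𝟎 ≡ α
++-𝟎 𝟎 = refl
++-𝟎 (ω^ a + a') = cong (ω^ a +_) (++-𝟎 a')

++-cancelˡ : ∀ α {u v} → α ++ u ≡ α ++ v → u ≡ v
++-cancelˡ 𝟎 p = p
++-cancelˡ (ω^ a + a') p = ++-cancelˡ a' (cong tail p)

++-≢𝟎 : ∀ α {β} → β ≢ 𝟎 → α ++ β ≢ 𝟎
++-≢𝟎 𝟎 β≢𝟎 = β≢𝟎
++-≢𝟎 (ω^ _ + _) _ ()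

⊕-𝟎 : ∀ α → α ⊕ 𝟎 ≡ α
⊕-𝟎 𝟎 = refl
⊕-𝟎 (ω^ _ + _) = refl

lastExp≤lead : ∀ {a b} → NF (ω^ a + b) → lastExp (ω^ a + b) ≤ₒ a
lastExp≤lead {b = 𝟎} _ = inj₂ refl
lastExp≤lead {a} {ω^ c + d} (nfω _ nfb lead) =
  ≤ₒ-trans {lastExp (ω^ c + d)} {c} {a} (lastExp≤lead nfb) lead

≤ₒ-⊕ : ∀ α γ → α ≤ₒ (α ⊕ γ)
≤ₒ-⊕ 𝟎 𝟎 = inj₂ refl
≤ₒ-⊕ 𝟎 (ω^ _ + _) = inj₁ refl
≤ₒ-⊕ (ω^ _ + _) 𝟎 = inj₂ refl
≤ₒ-⊕ (ω^ a + a') (ω^ c + d) with cmp a c in a?c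
... | lt = inj₁ (cmp-ω-lt a a' c d a?c)
... | eq = cons-mono-≤ₒ a (≤ₒ-⊕ a' (ω^ c + d))
... | gt = cons-mono-≤ₒ a (≤ₒ-⊕ a' (ω^ c + d))

mutual
  ⊕-append : ∀ {α β} → NF α → LeadLe β (lastExp α) → α ⊕ β ≡ α ++ β
  ⊕-append {𝟎} _ _ = refl
  ⊕-append {ω^ a + a'} {𝟎} _ _ = cong (ω^ a +_) (sym (++-𝟎 a'))
  ⊕-append {ω^ a + a'} {ω^ c + d} nfα@(nfω _ nfa' _) c≤last with cmp a c in a?c
  ... | lt = ⊥-elim (<-irrefl {a} (<-≤ₒ-trans {a} {c} {a} a?c
               (≤ₒ-trans {c} {lastExp (ω^ a + a')} {a} c≤last (lastExp≤lead nfα))))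
  ... | eq = cong (ω^ a +_) (⊕-append-tail nfa' c≤last)
  ... | gt = cong (ω^ a +_) (⊕-append-tail nfa' c≤last)

  -- the same for the tail a' of α, whose last exponent is that of α unless a' ≡ 0
  ⊕-append-tail : ∀ {a a' β} → NF a' → LeadLe β (lastExp (ω^ a + a')) → a' ⊕ β ≡ a' ++ β
  ⊕-append-tail {a' = 𝟎} _ _ = refl
  ⊕-append-tail {a' = ω^ _ + _} nfa' lead = ⊕-append nfa' lead

mutual
  lead-forced : ∀ α {c d w} → LeadLe w (lastExp α) →
    α ⊕ (ω^ c + d) ≡ α ++ w → c ≤ₒ lastExp α
  lead-forced 𝟎 lead refl = lead
  lead-forced (ω^ a + a') {c} lead p with cmp a c in a?c
  ... | lt with refl ← p = ⊥-elim (<-irrefl {a} a?c)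
  ... | eq = lead-forced-tail a a' lead (cong tail p)
  ... | gt = lead-forced-tail a a' lead (cong tail p)

  lead-forced-tail : ∀ a a' {c d w} → LeadLe w (lastExp (ω^ a + a')) →
    a' ⊕ (ω^ c + d) ≡ a' ++ w → c ≤ₒ lastExp (ω^ a + a')
  lead-forced-tail a 𝟎 lead refl = lead
  lead-forced-tail a (ω^ x + y) lead p = lead-forced (ω^ x + y) lead p

⊕-cancel : ∀ {α γ w} → NF α → LeadLe w (lastExp α) → α ⊕ γ ≡ α ++ w → γ ≡ w
⊕-cancel {α} {𝟎} _ _ p = ++-cancelˡ α (trans (trans (++-𝟎 α) (sym (⊕-𝟎 α))) p)
⊕-cancel {α} {ω^ c + d} nfα lead p =
  ++-cancelˡ α (trans (sym (⊕-append nfα (lead-forced α lead p))) p)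

⊕-𝟏 : ∀ x → x ⊕ 𝟏 ≡ x ++ 𝟏
⊕-𝟏 𝟎 = refl
⊕-𝟏 (ω^ a + a') with cmp a 𝟎 in a<𝟎
... | lt = ⊥-elim (≮𝟎 {a} a<𝟎)
... | eq = cong (ω^ a +_) (⊕-𝟏 a')
... | gt = cong (ω^ a +_) (⊕-𝟏 a')

<-suc⇒≤ₒ : ∀ c x → c < (x ++ 𝟏) → c ≤ₒ x
<-suc⇒≤ₒ 𝟎 𝟎 _ = inj₂ refl
<-suc⇒≤ₒ (ω^ p + q) 𝟎 c<𝟏 with cmp-ω-inv p q 𝟎 𝟎 c<𝟏
... | inj₁ p<𝟎 = ⊥-elim (≮𝟎 {p} p<𝟎)
... | inj₂ (_ , q<𝟎) = ⊥-elim (≮𝟎 {q} q<𝟎)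
<-suc⇒≤ₒ 𝟎 (ω^ _ + _) _ = inj₁ refl
<-suc⇒≤ₒ (ω^ p + q) (ω^ a + b) c<x+1 with cmp-ω-inv p q a (b ++ 𝟏) c<x+1
... | inj₁ p<a = inj₁ (cmp-ω-lt p q a b p<a)
... | inj₂ (refl , q<b+1) = cons-mono-≤ₒ p (<-suc⇒≤ₒ q b q<b+1)

meshes⇒LeadLe : ∀ {β e} → β < (ω^ (e ⊕ 𝟏) + 𝟎) → LeadLe β e
meshes⇒LeadLe {𝟎} _ = tt
meshes⇒LeadLe {ω^ c + d} {e} β<bound with cmp-ω-inv c d (e ⊕ 𝟏) 𝟎 β<bound
... | inj₁ c<e+1 = <-suc⇒≤ₒ c e (subst (c <_) (⊕-𝟏 e) c<e+1)
... | inj₂ (_ , d<𝟎) = ⊥-elim (≮𝟎 {d} d<𝟎)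

last-term-< : ∀ e n t → fs e n < e →
  (if t then copies (fs e n) (suc n) else ω^ (fs e n) + 𝟎) < (ω^ e + 𝟎)
last-term-< e n true e′<e = cmp-ω-lt (fs e n) (copies (fs e n) n) e 𝟎 e′<e
last-term-< e n false e′<e = cmp-ω-lt (fs e n) 𝟎 e 𝟎 e′<e

fs-< : ∀ x n → x ≢ 𝟎 → fs x n < x
fs-< 𝟎 n x≢𝟎 = ⊥-elim (x≢𝟎 refl)
fs-< (ω^ a + (ω^ c + d)) n _ =
  cmp-ω-eq a (fs (ω^ c + d) n) (ω^ c + d) (fs-< (ω^ c + d) n (λ ()))
fs-< (ω^ 𝟎 + 𝟎) n _ = refl
fs-< (ω^ (ω^ a + b) + 𝟎) n _ =
  last-term-< (ω^ a + b) n (isSucc (ω^ a + b)) (fs-< (ω^ a + b) n (λ ()))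

fs-≤ₒ : ∀ x n → fs x n ≤ₒ x
fs-≤ₒ 𝟎 n = inj₂ refl
fs-≤ₒ (ω^ a + b) n = inj₁ (fs-< (ω^ a + b) n (λ ()))

fund-antitone : ∀ x n {y₀ y} → y₀ ≤′ y → fund x n y ≤ₒ fund x n y₀
fund-antitone x n ≤′-refl = inj₂ refl
fund-antitone x n {y₀} (≤′-step {y} y₀≤y) =
  ≤ₒ-trans {fund x n (suc y)} {fund x n y} {fund x n y₀}
    (fs-≤ₒ (fund x n y) n) (fund-antitone x n y₀≤y)

fs-cons : ∀ a X n → X ≢ 𝟎 → fs (ω^ a + X) n ≡ ω^ a + fs X n
fs-cons a 𝟎 n X≢𝟎 = ⊥-elim (X≢𝟎 refl)
fs-cons a (ω^ _ + _) n _ = refl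

fs-++ : ∀ α {β} n → β ≢ 𝟎 → fs (α ++ β) n ≡ α ++ fs β n
fs-++ 𝟎 n _ = refl
fs-++ (ω^ a + a') {β} n β≢𝟎 =
  trans (fs-cons a (a' ++ β) n (++-≢𝟎 a' β≢𝟎)) (cong (ω^ a +_) (fs-++ a' n β≢𝟎))

data Tracking (α β : Ord) (n y : ℕ) : Set where
  running  : fund β n y ≢ 𝟎 → fund (α ++ β) n y ≡ α ++ fund β n y →
             Tracking α β n y
  finished : fund β n y ≡ 𝟎 → (y₀ : ℕ) → y₀ ≤ y → fund (α ++ β) n y₀ ≡ α →
             Tracking α β n y

fund-++-step : ∀ α β n y → fund β n y ≢ 𝟎 →
  fund (α ++ β) n y ≡ α ++ fund β n y →
  fund (α ++ β) n (suc y) ≡ α ++ fund β n (suc y)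
fund-++-step α β n y β≢𝟎 α++β↘ = trans (cong (λ t → fs t n) α++β↘) (fs-++ α n β≢𝟎)

is-𝟎 : ∀ x → (x ≡ 𝟎) ⊎ (x ≢ 𝟎)
is-𝟎 𝟎 = inj₁ refl
is-𝟎 (ω^ _ + _) = inj₂ (λ ())

tracking : ∀ α β n y → Tracking α β n y
tracking α 𝟎 n zero = finished refl zero z≤n (++-𝟎 α)
tracking α (ω^ _ + _) n zero = running (λ ()) refl
tracking α β n (suc y) with tracking α β n y
... | finished β↘𝟎 y₀ y₀≤y α++β↘α =
  finished (cong (λ t → fs t n) β↘𝟎) y₀ (≤-trans y₀≤y (n≤1+n y)) α++β↘α
... | running β≢𝟎 α++β↘ with is-𝟎 (fund β n (suc y))
...   | inj₁ β′≡𝟎 = finished β′≡𝟎 (suc y) ≤-refl (begin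
          fund (α ++ β) n (suc y)  ≡⟨ fund-++-step α β n y β≢𝟎 α++β↘ ⟩
          α ++ fund β n (suc y)    ≡⟨ cong (α ++_) β′≡𝟎 ⟩
          α ++ 𝟎                   ≡⟨ ++-𝟎 α ⟩
          α                        ∎)
  where open ≡-Reasoning
...   | inj₂ β′≢𝟎 = running β′≢𝟎 (fund-++-step α β n y β≢𝟎 α++β↘)

++-reaches-𝟎 : ∀ α β n x → (α ++ β) ↘[ n , x ] 𝟎 →
  ((α ++ β) ↘[ n , x ] α) × (β ↘[ n , x ] 𝟎)
++-reaches-𝟎 α β n x (y , y≤x , α++β↘𝟎) with tracking α β n y
... | running β≢𝟎 α++β↘ = ⊥-elim (++-≢𝟎 α β≢𝟎 (trans (sym α++β↘) α++β↘𝟎))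
... | finished β↘𝟎 y₀ y₀≤y α++β↘α = (y₀ , ≤-trans y₀≤y y≤x , α++β↘α) , (y , y≤x , β↘𝟎)

module Meshing {α β : Ord} (nfα : NF α) (mesh : LeadLe β (lastExp α)) (n : ℕ) where

  fund-meshes : ∀ y → LeadLe (fund β n y) (lastExp α)
  fund-meshes y = LeadLe-antitone mesh (fund-antitone β n {y = y} (≤⇒≤′ z≤n))

  forward : ∀ γ x → β ↘[ n , x ] γ → (α ++ β) ↘[ n , x ] (α ⊕ γ)
  forward γ x (y , y≤x , refl) with tracking α β n y
  ... | running _ α++β↘ = y , y≤x , trans α++β↘ (sym (⊕-append nfα (fund-meshes y)))
  ... | finished β↘𝟎 y₀ y₀≤y α++β↘α =
    y₀ , ≤-trans y₀≤y y≤x , trans α++β↘α (sym (trans (cong (α ⊕_) β↘𝟎) (⊕-𝟎 α)))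

  -- After β reached 0 the descent of α ++ β stays below α ≤ α ⊕ γ, so it can
  -- only meet α ⊕ γ when γ ≡ 0.
  backward : ∀ γ x → (α ++ β) ↘[ n , x ] (α ⊕ γ) → β ↘[ n , x ] γ
  backward γ x (y , y≤x , α++β↘αγ) = y , y≤x , sym (γ≡fund (tracking α β n y))
    where
    γ≡fund : Tracking α β n y → γ ≡ fund β n y
    γ≡fund (running _ α++β↘) =
      ⊕-cancel nfα (fund-meshes y) (trans (sym α++β↘αγ) α++β↘)
    γ≡fund (finished β↘𝟎 y₀ y₀≤y α++β↘α) =
      trans (⊕-cancel nfα tt (trans αγ≡α (sym (++-𝟎 α)))) (sym β↘𝟎)
      where
      αγ≡α : α ⊕ γ ≡ α
      αγ≡α = ≤ₒ-antisym
        (subst₂ _≤ₒ_ α++β↘αγ α++β↘α (fund-antitone (α ++ β) n (≤⇒≤′ y₀≤y)))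
        (≤ₒ-⊕ α γ)

lemma4p3 : (α β : Ord) → NF α → NF β → Meshes α β →
    ((γ : Ord) → NF γ → (n x : ℕ) →
      (β ↘[ n , x ] γ) ⇔ ((α ⊕ β) ↘[ n , x ] (α ⊕ γ)))
    × ((n x : ℕ) → (α ⊕ β) ↘[ n , x ] 𝟎 →
      ((α ⊕ β) ↘[ n , x ] α) × (β ↘[ n , x ] 𝟎))
lemma4p3 .𝟎 β _ _ (inj₁ refl) = (λ _ _ _ _ → mk⇔ id id) , (λ _ _ h → h , h)
lemma4p3 α β nfα _ (inj₂ β<ω^α₀+1)
  rewrite ⊕-append nfα (meshes⇒LeadLe {β} {lastExp α} β<ω^α₀+1) =
  (λ γ _ n x → mk⇔ (forward n γ x) (backward n γ x)) , ++-reaches-𝟎 α β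
  where
  mesh : LeadLe β (lastExp α)
  mesh = meshes⇒LeadLe {β} {lastExp α} β<ω^α₀+1
  open Meshing nfα mesh
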